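{- Let $G$ be a finite graph. If there exist cliques $S_1,S_2,\dots,S_k$ in $G$ such that $S_1\cup S_2\cup\dots\cup S_k$ is a dominating set of $G$, then $c_b(G)\le k$.
   Context: Bridge-burning Cops and Robbers is played on a finite graph $G$ by a team of cops and a single robber, with full information. First each cop chooses a starting vertex (several cops may share a vertex), then the robber chooses a starting vertex. The game then proceeds in rounds; in each round, first every cop either stays put or moves along an edge of the current graph to an adjacent vertex, and then the robber either stays put or moves along an edge of the current graph. Every edge traversed by the robber is immediately deleted from the graph (cop moves delete nothing). The cops win if at some moment some cop occupies the same vertex as the robber; the robber wins if he avoids this forever. $c_b(G)$ is the minimum number of cops for which the cops have a winning strategy. A set $S\subseteq V(G)$ is dominating if every vertex of $G$ is in $S$ or has a neighbor in $S$. -}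

module Defs where

open import Data.Nat using (ℕ; _≤_)
open import Data.Fin using (Fin; _≟_)
open import Data.Fin.Subset using (Subset; _∈_)
open import Data.Bool using (Bool; true; false; if_then_else_; _∧_; _∨_)
open import Data.Product using (Σ; ∃; _×_; _,_)
open import Data.Sum using (_⊎_)
open import Relation.Nullary using (¬_)
open import Relation.Nullary.Decidable using (⌊_⌋)
open import Relation.Binary.PropositionalEquality using (_≡_; _≢_)

record Graph : Set where
  field
    n      : ℕ
    adj    : Fin n → Fin n → Bool
    sym    : ∀ u v → adj u v ≡ adj v u
    irrefl : ∀ v → adj v v ≡ false
open Graph public

-- Current edge set during the game (symmetric Boolean matrix).
Edges : ℕ → Set
Edges n = Fin n → Fin n → Bool

delete : ∀ {n} → Edges n → Fin n → Fin n → Edges n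
delete E u v x y =
  if (⌊ x ≟ u ⌋ ∧ ⌊ y ≟ v ⌋) ∨ (⌊ x ≟ v ⌋ ∧ ⌊ y ≟ u ⌋) then false else E x y

Caught : ∀ {n k} → (Fin k → Fin n) → Fin n → Set
Caught c r = ∃ λ i → c i ≡ r

CopMove : ∀ {n k} → Edges n → (Fin k → Fin n) → (Fin k → Fin n) → Set
CopMove E c c' = ∀ i → (c' i ≡ c i) ⊎ (E (c i) (c' i) ≡ true)

-- CopWin E c r : it is the cops' turn, the current graph is E, cops are at c,
-- robber at r, and the cops can force capture (in finitely many rounds).
data CopWin {n k : ℕ} : Edges n → (Fin k → Fin n) → Fin n → Set where
  caught : ∀ {E c r} → Caught c r → CopWin E c r
  move   : ∀ {E c r} (c' : Fin k → Fin n) → CopMove E c c' →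
           (Caught c' r ⊎
             (CopWin E c' r ×
              (∀ r' → E r r' ≡ true → CopWin (delete E r r') c' r'))) →
           CopWin E c r

CopsWin : Graph → ℕ → Set
CopsWin G k = Σ (Fin k → Fin (n G)) λ c → ∀ r → CopWin (adj G) c r

-- c_b(G) ≤ k  (c_b is the minimum number of cops with a winning strategy).
cb≤ : Graph → ℕ → Set
cb≤ G k = ∃ λ j → j ≤ k × CopsWin G j

IsClique : (G : Graph) → Subset (n G) → Set
IsClique G S = ∀ u v → u ∈ S → v ∈ S → u ≢ v → adj G u v ≡ true

IsDominating : (G : Graph) → Subset (n G) → Set
IsDominating G D = ∀ v → v ∈ D ⊎ (∃ λ u → u ∈ D × adj G u v ≡ true)

module Submission where

-- Cop i always stands on a vertex of its clique S i (if S i is non-empty).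
-- Since the robber only deletes edges he walks along, and he is caught as
-- soon as he enters U, every edge with an endpoint in U stays intact: this
-- is the invariant 'Intact'.  Consequently, a cop can reach any vertex of
-- its own clique in one move.
--   * If the robber stands in U, say in S j, cop j captures him at once.
--   * Otherwise some u ∈ S i is adjacent to the robber; cop i moves to u.
--     If the robber stays, cop i captures him; if he steps into U, the
--     guard of that clique captures him (the deleted edge is not incident to
--     that guard); if he steps to a vertex outside U he has deleted an edge
--     outside U, the invariant persists, and the number of remaining edges
--     has strictly decreased.
-- The last case is handled by well-founded recursion on the edge count.

open import Defs
open import Data.List using (List; length; []; _∷_; lookup)
open import Data.List.Relation.Unary.All as All using (All)
open import Data.List.Membership.Propositional.Properties using (∈-lookup)
open import Data.Fin.Subset using (Subset; ⋃; _∈_; _∉_)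
open import Data.Fin.Subset.Properties using (x∈p∪q⁻; x∈p∪q⁺; ∉⊥; _∈?_)
open import Data.Fin using (Fin; zero; suc; _≟_)
open import Data.Fin.Properties using (any?)
open import Data.Nat using (ℕ; zero; suc; _+_; _≤_; _<_; z≤n; s≤s)
open import Data.Nat.Properties using (≤-refl; +-mono-≤; +-mono-<-≤; +-mono-≤-<)
open import Data.Nat.Induction using (<-wellFounded)
open import Induction.WellFounded using (Acc; acc)
open import Data.Bool using (Bool; true; false; if_then_else_)
open import Data.Product using (∃; _,_; proj₁; proj₂)
open import Data.Sum using (_⊎_; inj₁; inj₂)
open import Data.Empty using (⊥-elim)
open import Relation.Nullary using (¬_; Dec; yes; no; contradiction)
open import Relation.Binary.PropositionalEquality using (_≡_; _≢_; refl; trans; subst) renaming (sym to ≡-sym)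

Reach : ∀ {n} → Edges n → Fin n → Fin n → Set
Reach E x y = x ≡ y ⊎ E x y ≡ true

relocate : ∀ {n k} → (Fin k → Fin n) → Fin k → Fin n → Fin k → Fin n
relocate c i v j with j ≟ i
... | yes _ = v
... | no  _ = c j

relocate-here : ∀ {n k} (c : Fin k → Fin n) i v → relocate c i v i ≡ v
relocate-here c i v with i ≟ i
... | yes _  = refl
... | no i≢i = contradiction refl i≢i

relocate-moves : ∀ {n k} (E : Edges n) (c : Fin k → Fin n) i v →
                 Reach E (c i) v → CopMove E c (relocate c i v)
relocate-moves E c i v reach j with j ≟ i
... | no _ = inj₁ refl
relocate-moves E c i v (inj₁ refl) j | yes refl = inj₁ refl
relocate-moves E c i v (inj₂ e)    j | yes refl = inj₂ e

capture-in-one : ∀ {n k} {E : Edges n} {c : Fin k → Fin n} {r} i →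
                 Reach E (c i) r → CopWin E c r
capture-in-one {E = E} {c} {r} i reach =
  move (relocate c i r) (relocate-moves E c i r reach) (inj₁ (i , relocate-here c i r))

delete-away : ∀ {n} (E : Edges n) {u v x} y → x ≢ u → x ≢ v → delete E u v x y ≡ E x y
delete-away E {u} {v} {x} y x≢u x≢v with x ≟ u | x ≟ v
... | yes x≡u | _       = contradiction x≡u x≢u
... | no _    | yes x≡v = contradiction x≡v x≢v
... | no _    | no _    = refl

reach-delete : ∀ {n} (E : Edges n) {u x v} → x ≢ u → Reach E x v → Reach (delete E u v) x v
reach-delete E {x = x} {v} x≢u reach = by-cases (x ≟ v) reach
  where
  by-cases : Dec (x ≡ v) → Reach E x v → Reach (delete E _ v) x v
  by-cases (yes x≡v) _            = inj₁ x≡v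
  by-cases (no x≢v)  (inj₁ x≡v)   = contradiction x≡v x≢v
  by-cases (no x≢v)  (inj₂ e)     = inj₂ (trans (delete-away E v x≢u x≢v) e)

delete-hits : ∀ {n} (E : Edges n) u v → delete E u v u v ≡ false
delete-hits E u v with u ≟ u | v ≟ v
... | yes _  | yes _  = refl
... | no u≢u | _      = contradiction refl u≢u
... | yes _  | no v≢v = contradiction refl v≢v

weight : Bool → ℕ
weight true  = 1
weight false = 0

sumFin : ∀ m → (Fin m → ℕ) → ℕ
sumFin zero    f = 0
sumFin (suc m) f = f zero + sumFin m (λ i → f (suc i))

sumFin-mono : ∀ m {f g : Fin m → ℕ} → (∀ i → f i ≤ g i) → sumFin m f ≤ sumFin m g
sumFin-mono zero    f≤g = z≤n
sumFin-mono (suc m) f≤g = +-mono-≤ (f≤g zero) (sumFin-mono m (λ i → f≤g (suc i)))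

sumFin-strict : ∀ m {f g : Fin m → ℕ} → (∀ i → f i ≤ g i) → ∀ j → f j < g j →
                sumFin m f < sumFin m g
sumFin-strict (suc m) f≤g zero    lt = +-mono-<-≤ lt (sumFin-mono m (λ i → f≤g (suc i)))
sumFin-strict (suc m) f≤g (suc j) lt = +-mono-≤-< (f≤g zero) (sumFin-strict m (λ i → f≤g (suc i)) j lt)

edgeCount : ∀ {n} → Edges n → ℕ
edgeCount {n} E = sumFin n (λ x → sumFin n (λ y → weight (E x y)))

delete-≤ : ∀ {n} (E : Edges n) u v x y → weight (delete E u v x y) ≤ weight (E x y)
delete-≤ E u v x y = if-false-≤ _ (E x y)
  where
  if-false-≤ : ∀ b e → weight (if b then false else e) ≤ weight e
  if-false-≤ true  e = z≤n
  if-false-≤ false e = ≤-refl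

edgeCount-delete : ∀ {n} (E : Edges n) u v → E u v ≡ true → edgeCount (delete E u v) < edgeCount E
edgeCount-delete {n} E u v e =
  sumFin-strict n (λ x → sumFin-mono n (delete-≤ E u v x)) u
    (sumFin-strict n (delete-≤ E u v u) v hit)
  where
  hit : weight (delete E u v u v) < weight (E u v)
  hit rewrite delete-hits E u v | e = s≤s z≤n

∈⋃⁻ : ∀ {n} (S : List (Subset n)) {x} → x ∈ ⋃ S → ∃ λ (i : Fin (length S)) → x ∈ lookup S i
∈⋃⁻ []      x∈⋃ = contradiction x∈⋃ ∉⊥
∈⋃⁻ (p ∷ S) x∈⋃ with x∈p∪q⁻ p (⋃ S) x∈⋃
... | inj₁ x∈p = zero , x∈p
... | inj₂ x∈⋃S with ∈⋃⁻ S x∈⋃S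
...   | i , x∈Si = suc i , x∈Si

∈⋃⁺ : ∀ {n} (S : List (Subset n)) {x} (i : Fin (length S)) → x ∈ lookup S i → x ∈ ⋃ S
∈⋃⁺ (p ∷ S) zero    x∈p  = x∈p∪q⁺ (inj₁ x∈p)
∈⋃⁺ (p ∷ S) (suc i) x∈Si = x∈p∪q⁺ {p = p} (inj₂ (∈⋃⁺ S i x∈Si))

clique-reach : ∀ G {K} → IsClique G K → ∀ {x y} → x ∈ K → y ∈ K → Reach (adj G) x y
clique-reach G clique {x} {y} x∈K y∈K with x ≟ y
... | yes x≡y = inj₁ x≡y
... | no  x≢y = inj₂ (clique x y x∈K y∈K x≢y)

representative : ∀ {m} → Fin m → (p : Subset m) → ∃ λ x → ∀ {y} → y ∈ p → x ∈ p
representative d p with any? (_∈? p)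
... | yes (x , x∈p) = x , λ _ → x∈p
... | no  p-empty   = d , λ y∈p → contradiction (_ , y∈p) p-empty

vertexOrEmpty : ∀ m → Fin m ⊎ ¬ Fin m
vertexOrEmpty zero    = inj₂ λ ()
vertexOrEmpty (suc m) = inj₁ zero

-- To bound c_b it suffices to give a winning placement from any vertex:
-- on a graph without vertices zero cops win vacuously.
cb≤-from-vertex : ∀ G k → (Fin (n G) → CopsWin G k) → cb≤ G k
cb≤-from-vertex G k place with vertexOrEmpty (n G)
... | inj₁ v     = k , ≤-refl , place v
... | inj₂ empty = 0 , z≤n , (λ ()) , λ r → ⊥-elim (empty r)

module Strategy (G : Graph) (S : List (Subset (n G))) (cliques : All (IsClique G) S)
                (dominating : IsDominating G (⋃ S)) where

  N K : ℕ
  N = n G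
  K = length S

  U : Subset N
  U = ⋃ S

  clique : (i : Fin K) → Subset N
  clique = lookup S

  Guarding : (Fin K → Fin N) → Set
  Guarding c = ∀ i {x} → x ∈ clique i → c i ∈ clique i

  Intact : Edges N → Set
  Intact E = ∀ x y → x ∈ U → E x y ≡ adj G x y

  guard-in-U : ∀ {c} → Guarding c → ∀ j {x} → x ∈ clique j → c j ∈ U
  guard-in-U guard j x∈Sj = ∈⋃⁺ S j (guard j x∈Sj)

  guard-reach : ∀ {E c} → Intact E → Guarding c → ∀ j {x} → x ∈ clique j → Reach E (c j) x
  guard-reach {E} {c} intact guard j x∈Sj
    with clique-reach G (All.lookup cliques (∈-lookup j)) (guard j x∈Sj) x∈Sj
  ... | inj₁ cj≡x = inj₁ cj≡x
  ... | inj₂ e    = inj₂ (trans (intact (c j) _ (guard-in-U guard j x∈Sj)) e)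

  guarding-relocate : ∀ {c} → Guarding c → ∀ i {v} → v ∈ clique i → Guarding (relocate c i v)
  guarding-relocate {c} guard i v∈Si j x∈Sj with j ≟ i
  ... | yes refl = v∈Si
  ... | no  _    = guard j x∈Sj

  intact-delete : ∀ {E r r'} → Intact E → r ∉ U → r' ∉ U → Intact (delete E r r')
  intact-delete {E} intact r∉U r'∉U x y x∈U =
    trans (delete-away E y (λ { refl → r∉U x∈U }) (λ { refl → r'∉U x∈U })) (intact x y x∈U)

  win-from : ∀ E c r → Acc _<_ (edgeCount E) → Intact E → Guarding c → CopWin E c r
  win-from E c r (acc smaller) intact guard with r ∈? U
  ... | yes r∈U = let j , r∈Sj = ∈⋃⁻ S r∈U in capture-in-one j (guard-reach intact guard j r∈Sj)
  ... | no  r∉U with dominating r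
  ...   | inj₁ r∈U = contradiction r∈U r∉U
  ...   | inj₂ (u , u∈U , u~r) =
            move c' (relocate-moves E c i u (guard-reach intact guard i u∈Si)) (inj₂ (stay , flee))
    where
    i : Fin K
    i = proj₁ (∈⋃⁻ S u∈U)
    u∈Si : u ∈ clique i
    u∈Si = proj₂ (∈⋃⁻ S u∈U)

    c' : Fin K → Fin N
    c' = relocate c i u
    guard' : Guarding c'
    guard' = guarding-relocate guard i u∈Si

    stay : CopWin E c' r
    stay = capture-in-one i (subst (λ z → Reach E z r) (≡-sym (relocate-here c i u))
                                   (inj₂ (trans (intact u r u∈U) u~r)))

    flee : ∀ r' → E r r' ≡ true → CopWin (delete E r r') c' r'
    flee r' e with r' ∈? U
    ... | yes r'∈U = let j , r'∈Sj = ∈⋃⁻ S r'∈U in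
      -- cop j stands in U, hence not at r, so its edge to r' survived the deletion
      capture-in-one j (reach-delete E (λ { refl → r∉U (guard-in-U guard' j r'∈Sj) })
                                     (guard-reach intact guard' j r'∈Sj))
    ... | no r'∉U =
      win-from (delete E r r') c' r' (smaller (edgeCount-delete E r r' e))
               (intact-delete intact r∉U r'∉U) guard'

  placement : Fin N → CopsWin G K
  placement d = start , λ r → win-from (adj G) start r (<-wellFounded _) (λ _ _ _ → refl) guard
    where
    start : Fin K → Fin N
    start i = proj₁ (representative d (clique i))
    guard : Guarding start
    guard i = proj₂ (representative d (clique i))

theorem2p2 : (G : Graph) (S : List (Subset (Graph.n G))) →
    All (IsClique G) S → IsDominating G (⋃ S) → cb≤ G (length S)
theorem2p2 G S cliques dominating =
  cb≤-from-vertex G (length S) (Strategy.placement G S cliques dominating)
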